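{- Let $m\ge 3$, $X=\mathbb{F}_{2^m}\setminus\{0,1\}$, and let $W_3$ be as in the context. Then every element $x\in X$ lies in exactly $r_3=\frac{2^m-4}{2!}$ blocks of $W_3$ (the repetition number of $(X,W_2,W_3)$), and $|W_3|=\frac{(2^m-2)(2^m-4)}{3!}$.
   Context: $\mathbb{F}_{2^m}$ is the finite field with $2^m$ elements, with zero $0$ and unity $1$; all sums are in $\mathbb{F}_{2^m}$. For each integer $k\ge 2$, $W_k=\{B\subset X : |B|=k,\ \sum_{i\in B} i=1,\ \text{and } \binom{B}{\ell}\cap W_\ell=\emptyset \text{ for all } 2\le \ell\le k-3\}$ (recursive definition; $\binom{B}{\ell}$ is the set of $\ell$-subsets of $B$); in particular $W_3=\{B\subset X: |B|=3,\ \sum_{i\in B}i=1\}$. -}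

module Defs where

open import Level using (0ℓ)
open import Data.Nat using (ℕ; _≡ᵇ_)
open import Data.Bool using (Bool; true; false; _∧_; if_then_else_; T)
open import Data.Fin using (Fin)
open import Data.Fin.Subset using (Subset; inside; outside; ∣_∣)
open import Data.Vec using (Vec; foldr′; zipWith; tabulate; lookup)
open import Data.Product using (Σ; ∃)
open import Relation.Binary.PropositionalEquality using (_≡_; _≢_)
open import Relation.Binary.Definitions using (DecidableEquality)
open import Relation.Nullary.Decidable using (⌊_⌋; ¬?)
open import Algebra.Structures using (IsCommutativeRing)
open import Function.Bundles using (_↔_; Inverse)

-- All fields of order 2^m are isomorphic, so quantifying over
-- every such field is the same as talking about "the" field F_{2^m}.
record FiniteField (q : ℕ) : Set₁ where
  field
    Carrier : Set
    _+_ _*_ : Carrier → Carrier → Carrier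
    -_      : Carrier → Carrier
    0# 1#   : Carrier
    isCommutativeRing : IsCommutativeRing _≡_ _+_ _*_ -_ 0# 1#
    0≢1     : 0# ≢ 1#
    inverse : ∀ x → x ≢ 0# → ∃ λ y → x * y ≡ 1#
    _≟_     : DecidableEquality Carrier
    enum    : Fin q ↔ Carrier

module _ {q : ℕ} (F : FiniteField q) where
  open FiniteField F

  elt : Fin q → Carrier
  elt i = Inverse.to enum i

  idx : Carrier → Fin q
  idx x = Inverse.from enum x

  -- Subsets of F are represented as subsets of Fin q via the enumeration.
  -- x ∈ X = F \ {0,1}
  inXᵇ : Carrier → Bool
  inXᵇ x = ⌊ ¬? (x ≟ 0#) ⌋ ∧ ⌊ ¬? (x ≟ 1#) ⌋

  ⊆Xᵇ : Subset q → Bool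
  ⊆Xᵇ B = foldr′ _∧_ true
            (zipWith (λ b x → if b then inXᵇ x else true) B (tabulate elt))

  subsetSum : Subset q → Carrier
  subsetSum B = foldr′ _+_ 0#
            (zipWith (λ b x → if b then x else 0#) B (tabulate elt))

  isW3 : Subset q → Bool
  isW3 B = ⊆Xᵇ B ∧ (∣ B ∣ ≡ᵇ 3) ∧ ⌊ subsetSum B ≟ 1# ⌋

  W3 : Set
  W3 = Σ (Subset q) (λ B → T (isW3 B))

  W3-containing : Carrier → Set
  W3-containing x = Σ (Subset q) (λ B → T (isW3 B ∧ lookup B (idx x)))

-- Since q is even, F has characteristic two: otherwise y ↦ -y would pair
-- off the odd number q - 1 of non-zero elements.  Then {x, y, z} sums to 1
-- iff z = σ y := (1 + x) + y, so the flags (B, y) with x ≠ y ∈ B ∈ W₃ are in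
-- bijection with the points y of X ∖ {x, 1 + x}; each block through x
-- carries two flags, whence 2 r₃ = q - 4.  Counting the pairs (block, point
-- of it) by blocks and by points gives 3 |W₃| = |X| r₃ = (q - 2) r₃.
module Submission where

open import Defs
open import Level using (0ℓ)
open import Data.Nat as ℕ using (ℕ; zero; suc; _+_; _*_; _<_; _∸_; _^_; _≤_; s≤s; z≤n)
import Data.Nat.Properties as ℕₚ
open import Data.Nat.DivMod using (_/_; m*n/n≡m)
open import Data.Nat.Tactic.RingSolver using (solve-∀)
open import Data.Bool using (Bool; true; false; _∧_; _∨_; not; if_then_else_; T)
open import Data.Bool.Properties using (T-irrelevant; T-≡; T-∧; ∧-identityʳ)
open import Data.Unit using (tt)
open import Data.Empty using (⊥-elim)
open import Data.Fin using (Fin; zero; suc; toℕ; _≟_)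
open import Data.Fin.Properties using (+↔⊎; *↔×; 0↔⊥; 1↔⊤; 2↔Bool; ¬Fin0; toℕ-injective)
open import Data.Fin.Permutation using (↔⇒≡)
open import Data.Fin.Subset using (Subset; ∣_∣)
open import Data.Vec using (Vec; []; _∷_; foldr′; zipWith; lookup; tabulate)
open import Data.Vec.Properties using (lookup∘tabulate; tabulate∘lookup; tabulate-cong)
open import Data.Product using (Σ; _,_; proj₁; proj₂; _×_)
open import Data.Product.Function.Dependent.Propositional using (Σ-↔)
open import Data.Product.Function.NonDependent.Propositional using (_×-↔_)
open import Data.Sum using (_⊎_; inj₁; inj₂; [_,_]′)
open import Data.Sum.Function.Propositional using (_⊎-↔_)
open import Function using (_∘_; _⇔_; mk⇔; Equivalence)
open import Function.Bundles using (_↔_; Inverse; mk↔ₛ′)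
open import Function.Properties.Inverse using (↔-trans; ↔-sym; ↔-refl)
open import Relation.Binary.PropositionalEquality
open import Relation.Binary.Definitions using (tri<; tri≈; tri>)
open import Relation.Nullary using (¬_; Dec; yes; no; does; contradiction)
open import Relation.Nullary.Decidable using (dec-true; toWitness; fromWitness; ¬?)
open import Algebra.Bundles using (AbelianGroup)
open import Algebra.Structures using (IsCommutativeMonoid; IsCommutativeRing)
import Algebra.Properties.AbelianGroup as AbelianGroupProperties

Sat : {A : Set} → (A → Bool) → Set
Sat {A} p = Σ A (T ∘ p)

Sat-≡ : {A : Set} (p : A → Bool) {a b : A} {x : T (p a)} {y : T (p b)} →
        a ≡ b → _≡_ {A = Sat p} (a , x) (b , y)
Sat-≡ p {a} refl = cong (a ,_) (T-irrelevant _ _)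

Sat-transfer : {A B : Set} (e : A ↔ B) (p : A → Bool) → Sat p ↔ Sat (p ∘ Inverse.from e)
Sat-transfer e p = mk↔ₛ′ to′ from′ (λ (b , _) → Sat-≡ (p ∘ from) (strictlyInverseˡ b))
                                    (λ (a , _) → Sat-≡ p (strictlyInverseʳ a))
  where
  open Inverse e
  to′ : Sat p → Sat (p ∘ from)
  to′ (a , t) = to a , subst (T ∘ p) (sym (strictlyInverseʳ a)) t
  from′ : Sat (p ∘ from) → Sat p
  from′ (b , t) = from b , t

T-ext : ∀ {a b} → (T a → T b) → (T b → T a) → a ≡ b
T-ext {false} {false} _ _ = refl
T-ext {false} {true}  _ f = ⊥-elim (f tt)
T-ext {true}  {false} f _ = ⊥-elim (f tt)
T-ext {true}  {true}  _ _ = refl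

does-T : ∀ {P : Set} (d : Dec P) → P → T (does d)
does-T d p = Equivalence.from T-≡ (dec-true d p)

T-does : ∀ {P : Set} (d : Dec P) → T (does d) → P
T-does (yes p) _ = p

all : ∀ {n} → Fin n → Bool
all _ = true

infixl 5 _∖_
_∖_ : ∀ {n} → (Fin n → Bool) → Fin n → Fin n → Bool
(p ∖ j) i = p i ∧ not (does (i ≟ j))

∖-elim : ∀ {n} (p : Fin n → Bool) {j i} → T ((p ∖ j) i) → T (p i) × i ≢ j
∖-elim p {j} {i} t with i ≟ j
... | yes _   = ⊥-elim (proj₂ (Equivalence.to T-∧ t))
... | no i≢j  = proj₁ (Equivalence.to T-∧ t) , i≢j

∖-intro : ∀ {n} (p : Fin n → Bool) {j i} → T (p i) → i ≢ j → T ((p ∖ j) i)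
∖-intro p {j} {i} pi i≢j with i ≟ j
... | yes i≡j = contradiction i≡j i≢j
... | no _    = Equivalence.from T-∧ (pi , tt)

triple : ∀ {n} → Fin n → Fin n → Fin n → Fin n → Bool
triple a b c i = does (i ≟ a) ∨ does (i ≟ b) ∨ does (i ≟ c)

module _ {n} (a b c : Fin n) where

  triple-∈ : ∀ {i} → T (triple a b c i) → i ≡ a ⊎ i ≡ b ⊎ i ≡ c
  triple-∈ {i} t with i ≟ a | i ≟ b | i ≟ c
  ... | yes i≡a | _       | _       = inj₁ i≡a
  ... | no _    | yes i≡b | _       = inj₂ (inj₁ i≡b)
  ... | no _    | no _    | yes i≡c = inj₂ (inj₂ i≡c)

  triple-∋ : ∀ {i} → i ≡ a ⊎ i ≡ b ⊎ i ≡ c → T (triple a b c i)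
  triple-∋ {i} i∈ with i ≟ a | i ≟ b | i ≟ c
  ... | yes _   | _       | _       = tt
  ... | no _    | yes _   | _       = tt
  ... | no _    | no _    | yes _   = tt
  ... | no i≢a  | no i≢b  | no i≢c  = [ i≢a , [ i≢b , i≢c ]′ ]′ i∈

-- Sums Σ_{i ∈ p} f i over a subset p of Fin n, with values in any
-- commutative monoid.  Counting is the case of ℕ with f = 1; subset sums
-- in a field are the case of its additive group.
module SubsetSum {A : Set} {_∙_ : A → A → A} {ε : A} (isCM : IsCommutativeMonoid _≡_ _∙_ ε) where
  open IsCommutativeMonoid isCM using (identityˡ; identityʳ; assoc; comm)

  sumOver : ∀ {n} → (Fin n → Bool) → (Fin n → A) → A
  sumOver {zero}  p f = ε
  sumOver {suc n} p f = (if p zero then f zero else ε) ∙ sumOver (p ∘ suc) (f ∘ suc)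

  sumOver-cong : ∀ {n} {p p′ : Fin n → Bool} {f f′ : Fin n → A} →
    (∀ i → p i ≡ p′ i) → (∀ i → f i ≡ f′ i) → sumOver p f ≡ sumOver p′ f′
  sumOver-cong {zero}  _  _  = refl
  sumOver-cong {suc n} hp hf = cong₂ _∙_ (cong₂ (λ b x → if b then x else ε) (hp zero) (hf zero))
                                         (sumOver-cong (hp ∘ suc) (hf ∘ suc))

  sumOver-all : ∀ {n} (p : Fin n → Bool) f → sumOver all (λ i → if p i then f i else ε) ≡ sumOver p f
  sumOver-all {zero}  p f = refl
  sumOver-all {suc n} p f = cong (_ ∙_) (sumOver-all (p ∘ suc) (f ∘ suc))

  sumOver-empty : ∀ {n} (p : Fin n → Bool) f → (∀ i → ¬ T (p i)) → sumOver p f ≡ ε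
  sumOver-empty {zero}  p f _ = refl
  sumOver-empty {suc n} p f h with p zero | h zero
  ... | false | _  = trans (identityˡ _) (sumOver-empty (p ∘ suc) (f ∘ suc) (h ∘ suc))
  ... | true  | ¬t = ⊥-elim (¬t tt)

  sumOver-∖ : ∀ {n} (p : Fin n → Bool) f j → T (p j) → sumOver p f ≡ f j ∙ sumOver (p ∖ j) f
  sumOver-∖ {suc n} p f zero    pj with p zero
  ... | false = ⊥-elim pj
  ... | true  = cong (f zero ∙_) (trans (sumOver-cong (λ i → sym (∧-identityʳ (p (suc i)))) (λ _ → refl))
                                       (sym (identityˡ _)))
  sumOver-∖ {suc n} p f (suc j) pj = begin
    head ∙ sumOver (p ∘ suc) (f ∘ suc)         ≡⟨ cong (head ∙_) (sumOver-∖ (p ∘ suc) (f ∘ suc) j pj) ⟩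
    head ∙ (f (suc j) ∙ rest)                  ≡⟨ sym (assoc _ _ _) ⟩
    (head ∙ f (suc j)) ∙ rest                  ≡⟨ cong (_∙ rest) (comm _ _) ⟩
    (f (suc j) ∙ head) ∙ rest                  ≡⟨ assoc _ _ _ ⟩
    f (suc j) ∙ (head ∙ rest)                  ≡⟨ cong (λ b → f (suc j) ∙ ((if b then f zero else ε) ∙ rest))
                                                       (sym (∧-identityʳ (p zero))) ⟩
    f (suc j) ∙ sumOver (p ∖ suc j) f          ∎
    where
    open ≡-Reasoning
    head = if p zero then f zero else ε
    rest = sumOver ((p ∘ suc) ∖ j) (f ∘ suc)

  sumOver-triple : ∀ {n} {a b c : Fin n} f → a ≢ b → a ≢ c → b ≢ c →
    sumOver (triple a b c) f ≡ f a ∙ (f b ∙ f c)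
  sumOver-triple {a = a} {b} {c} f a≢b a≢c b≢c = begin
    sumOver (triple a b c) f                                ≡⟨ sumOver-∖ _ f a (triple-∋ a b c (inj₁ refl)) ⟩
    f a ∙ sumOver (triple a b c ∖ a) f                      ≡⟨ cong (f a ∙_) (sumOver-∖ _ f b b∈) ⟩
    f a ∙ (f b ∙ sumOver (triple a b c ∖ a ∖ b) f)          ≡⟨ cong (λ s → f a ∙ (f b ∙ s)) (sumOver-∖ _ f c c∈) ⟩
    f a ∙ (f b ∙ (f c ∙ sumOver (triple a b c ∖ a ∖ b ∖ c) f)) ≡⟨ cong (λ s → f a ∙ (f b ∙ (f c ∙ s)))
                                                                      (sumOver-empty _ f nothing-left) ⟩
    f a ∙ (f b ∙ (f c ∙ ε))                                  ≡⟨ cong (λ s → f a ∙ (f b ∙ s)) (identityʳ (f c)) ⟩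
    f a ∙ (f b ∙ f c)                                        ∎
    where
    open ≡-Reasoning
    b∈ : T ((triple a b c ∖ a) b)
    b∈ = ∖-intro (triple a b c) (triple-∋ a b c (inj₂ (inj₁ refl))) (≢-sym a≢b)
    c∈ : T ((triple a b c ∖ a ∖ b) c)
    c∈ = ∖-intro (triple a b c ∖ a) (∖-intro (triple a b c) (triple-∋ a b c (inj₂ (inj₂ refl))) (≢-sym a≢c)) (≢-sym b≢c)
    nothing-left : ∀ i → ¬ T ((triple a b c ∖ a ∖ b ∖ c) i)
    nothing-left i t with ∖-elim (triple a b c ∖ a ∖ b) {i = i} t
    ... | t′ , i≢c with ∖-elim (triple a b c ∖ a) {i = i} t′
    ... | t″ , i≢b with ∖-elim (triple a b c) {i = i} t″
    ... | t‴ , i≢a = [ i≢a , [ i≢b , i≢c ]′ ]′ (triple-∈ a b c t‴)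

  sumOver-vec : ∀ {n} (B : Vec Bool n) (v : Vec A n) →
    foldr′ _∙_ ε (zipWith (λ b x → if b then x else ε) B v) ≡ sumOver (lookup B) (lookup v)
  sumOver-vec []      []      = refl
  sumOver-vec (b ∷ B) (x ∷ v) = cong (_ ∙_) (sumOver-vec B v)

module ℕ-sum = SubsetSum ℕₚ.+-0-isCommutativeMonoid
open ℕ-sum using (sumOver; sumOver-cong; sumOver-all)

count : ∀ n → (Fin n → Bool) → ℕ
count n p = sumOver {n} p (λ _ → 1)

count-cong : ∀ n {p p′ : Fin n → Bool} → (∀ i → p i ≡ p′ i) → count n p ≡ count n p′
count-cong n p≗p′ = sumOver-cong p≗p′ (λ _ → refl)

count-all : ∀ n → count n all ≡ n
count-all zero    = refl
count-all (suc n) = cong suc (count-all n)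

count-∖ : ∀ n (p : Fin n → Bool) j → T (p j) → count n p ≡ suc (count n (p ∖ j))
count-∖ n p = ℕ-sum.sumOver-∖ p (λ _ → 1)

count-triple : ∀ {n} {a b c : Fin n} → a ≢ b → a ≢ c → b ≢ c → count n (triple a b c) ≡ 3
count-triple = ℕ-sum.sumOver-triple (λ _ → 1)

sumOver-const : ∀ n (p : Fin n → Bool) k → sumOver p (λ _ → k) ≡ count n p * k
sumOver-const zero    p k = refl
sumOver-const (suc n) p k with p zero
... | true  = cong (k +_) (sumOver-const n (p ∘ suc) k)
... | false = sumOver-const n (p ∘ suc) k

Σ-Fin↔sum : ∀ n (f : Fin n → ℕ) → Σ (Fin n) (Fin ∘ f) ↔ Fin (sumOver all f)
Σ-Fin↔sum zero    f = mk↔ₛ′ (λ ()) (λ ()) (λ ()) (λ ())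
Σ-Fin↔sum (suc n) f =
  ↔-trans split (↔-trans (↔-refl ⊎-↔ Σ-Fin↔sum n (f ∘ suc)) (↔-sym +↔⊎))
  where
  split : Σ (Fin (suc n)) (Fin ∘ f) ↔ (Fin (f zero) ⊎ Σ (Fin n) (Fin ∘ f ∘ suc))
  split = mk↔ₛ′ to′ from′ to∘from from∘to
    where
    to′ : Σ (Fin (suc n)) (Fin ∘ f) → Fin (f zero) ⊎ Σ (Fin n) (Fin ∘ f ∘ suc)
    to′ (zero  , x) = inj₁ x
    to′ (suc i , x) = inj₂ (i , x)
    from′ : Fin (f zero) ⊎ Σ (Fin n) (Fin ∘ f ∘ suc) → Σ (Fin (suc n)) (Fin ∘ f)
    from′ (inj₁ x)       = zero , x
    from′ (inj₂ (i , x)) = suc i , x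
    to∘from : ∀ y → to′ (from′ y) ≡ y
    to∘from (inj₁ _) = refl
    to∘from (inj₂ _) = refl
    from∘to : ∀ y → from′ (to′ y) ≡ y
    from∘to (zero  , _) = refl
    from∘to (suc _ , _) = refl

Sat↔count : ∀ n (p : Fin n → Bool) → Sat p ↔ Fin (count n p)
Sat↔count n p = ↔-trans (Σ-↔ ↔-refl λ {i} → T↔𝟙 (p i))
                        (subst (λ c → Σ (Fin n) _ ↔ Fin c) (sumOver-all p (λ _ → 1))
                               (Σ-Fin↔sum n (λ i → if p i then 1 else 0)))
  where
  T↔𝟙 : ∀ b → T b ↔ Fin (if b then 1 else 0)
  T↔𝟙 false = ↔-sym 0↔⊥
  T↔𝟙 true  = ↔-sym 1↔⊤

Sat↔count-via : ∀ {A : Set} {n} (e : A ↔ Fin n) (p : A → Bool) →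
  Sat p ↔ Fin (count n (p ∘ Inverse.from e))
Sat↔count-via {n = n} e p = ↔-trans (Sat-transfer e p) (Sat↔count n (p ∘ Inverse.from e))

count-zero⇒empty : ∀ n (p : Fin n → Bool) → count n p ≡ 0 → ∀ i → ¬ T (p i)
count-zero⇒empty n p c i t = ¬Fin0 (subst Fin c (Inverse.to (Sat↔count n p) (i , t)))

count-suc⇒witness : ∀ n (p : Fin n → Bool) {k} → count n p ≡ suc k → Sat p
count-suc⇒witness n p c = Inverse.from (Sat↔count n p) (subst Fin (sym c) zero)

Σ-constant-fibres : {A : Set} {P : A → Set} {a c : ℕ} →
  A ↔ Fin a → (∀ x → P x ↔ Fin c) → Σ A P ↔ Fin (a * c)
Σ-constant-fibres A↔ P↔ = ↔-trans (Σ-↔ A↔ (λ {x} → P↔ x)) (↔-sym *↔×)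

empty↔Fin0 : {A : Set} → ¬ A → A ↔ Fin 0
empty↔Fin0 ¬a = mk↔ₛ′ (⊥-elim ∘ ¬a) (λ ()) (λ ()) (⊥-elim ∘ ¬a)

third-point : ∀ n (p : Fin n → Bool) {a b} → count n p ≡ 3 → T (p a) → T (p b) → a ≢ b →
  Σ (Fin n) λ c → a ≢ c × b ≢ c × (∀ i → p i ≡ triple a b c i)
third-point n p {a} {b} #p≡3 pa pb a≢b = c , ≢-sym c≢a , ≢-sym c≢b , λ i → T-ext (⊆triple i) (triple⊆ i)
  where
  #p∖a∖b≡1 : count n (p ∖ a ∖ b) ≡ 1
  #p∖a∖b≡1 = ℕₚ.suc-injective (ℕₚ.suc-injective (begin
    suc (suc (count n (p ∖ a ∖ b))) ≡⟨ cong suc (count-∖ n (p ∖ a) b (∖-intro p pb (≢-sym a≢b))) ⟨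
    suc (count n (p ∖ a))           ≡⟨ count-∖ n p a pa ⟨
    count n p                       ≡⟨ #p≡3 ⟩
    3                               ∎))
    where open ≡-Reasoning
  witness : Sat (p ∖ a ∖ b)
  witness = count-suc⇒witness n (p ∖ a ∖ b) #p∖a∖b≡1
  c : Fin n
  c = proj₁ witness
  pc : T (p c)
  pc = proj₁ (∖-elim p (proj₁ (∖-elim (p ∖ a) (proj₂ witness))))
  c≢a : c ≢ a
  c≢a = proj₂ (∖-elim p (proj₁ (∖-elim (p ∖ a) (proj₂ witness))))
  c≢b : c ≢ b
  c≢b = proj₂ (∖-elim (p ∖ a) (proj₂ witness))
  nothing-left : ∀ i → ¬ T ((p ∖ a ∖ b ∖ c) i)
  nothing-left = count-zero⇒empty n _
    (ℕₚ.suc-injective (trans (sym (count-∖ n (p ∖ a ∖ b) c (proj₂ witness))) #p∖a∖b≡1))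
  ⊆triple : ∀ i → T (p i) → T (triple a b c i)
  -- in the first three cases triple a b c i computes to true
  ⊆triple i pi with i ≟ a | i ≟ b | i ≟ c
  ... | yes _   | _       | _       = tt
  ... | no _    | yes _   | _       = tt
  ... | no _    | no _    | yes _   = tt
  ... | no i≢a  | no i≢b  | no i≢c  = ⊥-elim (nothing-left i (∖-intro (p ∖ a ∖ b) (∖-intro (p ∖ a) (∖-intro p pi i≢a) i≢b) i≢c))
  triple⊆ : ∀ i → T (triple a b c i) → T (p i)
  triple⊆ i t with triple-∈ a b c {i} t
  ... | inj₁ refl        = pa
  ... | inj₂ (inj₁ refl) = pb
  ... | inj₂ (inj₂ refl) = pc

Subset↔ : ∀ n → Vec Bool n ↔ Fin (2 ^ n)
Subset↔ zero    = mk↔ₛ′ (λ _ → zero) (λ _ → []) (λ { zero → refl }) (λ { [] → refl })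
Subset↔ (suc n) = ↔-trans uncons (↔-trans (↔-sym 2↔Bool ×-↔ Subset↔ n) (↔-sym (*↔× {2} {2 ^ n})))
  where
  uncons : Vec Bool (suc n) ↔ (Bool × Vec Bool n)
  uncons = mk↔ₛ′ (λ { (b ∷ v) → b , v }) (λ (b , v) → b ∷ v) (λ _ → refl) (λ { (_ ∷ _) → refl })

∣∣≡count : ∀ {n} (B : Subset n) → ∣ B ∣ ≡ count n (lookup B)
∣∣≡count []          = refl
∣∣≡count (true  ∷ B) = cong suc (∣∣≡count B)
∣∣≡count (false ∷ B) = ∣∣≡count B

T-implications : ∀ {A : Set} {n} (c : A → Bool) (B : Vec Bool n) (v : Vec A n) →
  T (foldr′ _∧_ true (zipWith (λ b x → if b then c x else true) B v)) ⇔
  (∀ i → T (lookup B i) → T (c (lookup v i)))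
T-implications c B v = mk⇔ (to B v) (from B v)
  where
  to : ∀ {n} (B : Vec Bool n) (v : Vec _ n) → T (foldr′ _∧_ true (zipWith (λ b x → if b then c x else true) B v)) →
       ∀ i → T (lookup B i) → T (c (lookup v i))
  to (true  ∷ B) (x ∷ v) t zero    _ = proj₁ (Equivalence.to T-∧ t)
  to (true  ∷ B) (x ∷ v) t (suc i)   = to B v (proj₂ (Equivalence.to T-∧ t)) i
  to (false ∷ B) (x ∷ v) t zero    ()
  to (false ∷ B) (x ∷ v) t (suc i)   = to B v t i
  from : ∀ {n} (B : Vec Bool n) (v : Vec _ n) → (∀ i → T (lookup B i) → T (c (lookup v i))) →
         T (foldr′ _∧_ true (zipWith (λ b x → if b then c x else true) B v))
  from []          []      h = tt
  from (true  ∷ B) (x ∷ v) h = Equivalence.from T-∧ (h zero tt , from B v (h ∘ suc))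
  from (false ∷ B) (x ∷ v) h = from B v (h ∘ suc)

-- A fixed-point-free involution σ of {i | p i} pairs its elements off:
-- taking from each pair {i, σ i} the smaller member as representative,
-- the set is two copies of the set of representatives, so it is even.
module FreeInvolution {n} (p : Fin n → Bool) (σ : Fin n → Fin n)
  (σ-closed : ∀ {i} → T (p i) → T (p (σ i)))
  (σ-involutive : ∀ i → σ (σ i) ≡ i)
  (σ-free : ∀ {i} → T (p i) → σ i ≢ i) where

  isRep : Fin n → Bool
  isRep i = p i ∧ does (toℕ i ℕ.<? toℕ (σ i))

  rep-intro : ∀ {i} → T (p i) → toℕ i < toℕ (σ i) → T (isRep i)
  rep-intro {i} pi lt = Equivalence.from T-∧ (pi , does-T (toℕ i ℕ.<? toℕ (σ i)) lt)

  rep-elim : ∀ {i} → T (isRep i) → T (p i) × toℕ i < toℕ (σ i)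
  rep-elim {i} r with Equivalence.to T-∧ r
  ... | pi , lt = pi , T-does (toℕ i ℕ.<? toℕ (σ i)) lt

  -- σ (σ i) has the index of i, which lets us compare a pair from either side
  σσ-index : ∀ i → toℕ (σ (σ i)) ≡ toℕ i
  σσ-index i = cong toℕ (σ-involutive i)

  split : Sat p → Sat isRep ⊎ Sat isRep
  split (i , pi) with ℕₚ.<-cmp (toℕ i) (toℕ (σ i))
  ... | tri< lt _ _ = inj₁ (i , rep-intro pi lt)
  ... | tri≈ _ eq _ = ⊥-elim (σ-free pi (toℕ-injective (sym eq)))
  ... | tri> _ _ gt = inj₂ (σ i , rep-intro (σ-closed pi) (subst (toℕ (σ i) <_) (sym (σσ-index i)) gt))

  merge : Sat isRep ⊎ Sat isRep → Sat p
  merge (inj₁ (i , r)) = i , proj₁ (rep-elim r)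
  merge (inj₂ (i , r)) = σ i , σ-closed (proj₁ (rep-elim r))

  merge∘split : ∀ x → merge (split x) ≡ x
  merge∘split (i , pi) with ℕₚ.<-cmp (toℕ i) (toℕ (σ i))
  ... | tri< _ _ _  = Sat-≡ p refl
  ... | tri≈ _ eq _ = ⊥-elim (σ-free pi (toℕ-injective (sym eq)))
  ... | tri> _ _ _  = Sat-≡ p (σ-involutive i)

  split∘merge : ∀ y → split (merge y) ≡ y
  split∘merge (inj₁ (i , r)) with ℕₚ.<-cmp (toℕ i) (toℕ (σ i))
  ... | tri< _ _ _  = cong inj₁ (Sat-≡ isRep refl)
  ... | tri≈ _ eq _ = ⊥-elim (ℕₚ.<-irrefl eq (proj₂ (rep-elim r)))
  ... | tri> _ _ gt = ⊥-elim (ℕₚ.<-asym gt (proj₂ (rep-elim r)))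
  split∘merge (inj₂ (i , r)) with ℕₚ.<-cmp (toℕ (σ i)) (toℕ (σ (σ i)))
  ... | tri< lt _ _ = ⊥-elim (ℕₚ.<-asym (proj₂ (rep-elim r)) (subst (toℕ (σ i) <_) (σσ-index i) lt))
  ... | tri≈ _ eq _ = ⊥-elim (ℕₚ.<-irrefl (trans (sym (σσ-index i)) (sym eq)) (proj₂ (rep-elim r)))
  ... | tri> _ _ _  = cong inj₂ (Sat-≡ isRep (σ-involutive i))

  count-even : count n p ≡ 2 * count n isRep
  count-even = trans (↔⇒≡ (↔-trans (↔-sym (Sat↔count n p))
                          (↔-trans (mk↔ₛ′ split merge split∘merge merge∘split)
                          (↔-trans (Sat↔count n isRep ⊎-↔ Sat↔count n isRep) (↔-sym +↔⊎)))))
                     (cong (count n isRep +_) (sym (ℕₚ.+-identityʳ _)))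

module FieldFacts {q} (F : FiniteField q) where
  open FiniteField F renaming (_+_ to infixl 6 _⊕_; _*_ to infixl 7 _⊗_; _≟_ to _≈?_)
  open IsCommutativeRing isCommutativeRing
    using (+-isAbelianGroup; *-identityʳ; *-assoc; distribˡ; zeroˡ; -‿inverseʳ)

  +-group : AbelianGroup 0ℓ 0ℓ
  +-group = record { isAbelianGroup = +-isAbelianGroup }

  open AbelianGroupProperties +-group using (⁻¹-involutive; ε⁻¹≈ε)

  el : Fin q → Carrier
  el = elt F

  ix : Carrier → Fin q
  ix = idx F

  el∘ix : ∀ a → el (ix a) ≡ a
  el∘ix = Inverse.strictlyInverseˡ enum

  ix∘el : ∀ i → ix (el i) ≡ i
  ix∘el = Inverse.strictlyInverseʳ enum

  ix-injective : ∀ {a b} → ix a ≡ ix b → a ≡ b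
  ix-injective {a} {b} eq = trans (sym (el∘ix a)) (trans (cong el eq) (el∘ix b))

  ≢ix⇒≢ : ∀ {i a} → i ≢ ix a → el i ≢ a
  ≢ix⇒≢ {i} i≢ eq = i≢ (trans (sym (ix∘el i)) (cong ix eq))

  ≢⇒≢ix : ∀ {i a} → el i ≢ a → i ≢ ix a
  ≢⇒≢ix {i} {a} el≢ eq = el≢ (trans (cong el eq) (el∘ix a))

  y+y≡0⇒y≡0 : 1# ⊕ 1# ≢ 0# → ∀ y → y ⊕ y ≡ 0# → y ≡ 0#
  y+y≡0⇒y≡0 2≢0 y y+y≡0 = begin
    y                      ≡⟨ sym (*-identityʳ y) ⟩
    y ⊗ 1#                 ≡⟨ cong (y ⊗_) (sym (proj₂ (inverse _ 2≢0))) ⟩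
    y ⊗ ((1# ⊕ 1#) ⊗ ½)    ≡⟨ sym (*-assoc _ _ _) ⟩
    (y ⊗ (1# ⊕ 1#)) ⊗ ½    ≡⟨ cong (_⊗ ½) y·2≡0 ⟩
    0# ⊗ ½                 ≡⟨ zeroˡ ½ ⟩
    0#                     ∎
    where
    open ≡-Reasoning
    ½ = proj₁ (inverse _ 2≢0)
    y·2≡0 : y ⊗ (1# ⊕ 1#) ≡ 0#
    y·2≡0 = trans (distribˡ y 1# 1#) (trans (cong₂ _⊕_ (*-identityʳ y) (*-identityʳ y)) y+y≡0)

  CharacteristicTwo : Set
  CharacteristicTwo = 1# ⊕ 1# ≡ 0#

  nonzero : Fin q → Bool
  nonzero = all ∖ ix 0#

  -- A finite field of even order has characteristic two: otherwise
  -- y ↦ -y would be a fixed-point-free involution of the q - 1 non-zero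
  -- elements, making q - 1 even.
  even-order⇒char-two : ∀ k → q ≡ 2 * k → CharacteristicTwo
  even-order⇒char-two k q≡2k with (1# ⊕ 1#) ≈? 0#
  ... | yes 2≡0 = 2≡0
  ... | no  2≢0 = ⊥-elim (ℕₚ.even≢odd k (count q isRep) (trans (sym q≡2k) q≡odd))
    where
    neg : Fin q → Fin q
    neg i = ix (- el i)

    neg-closed : ∀ {i} → T (nonzero i) → T (nonzero (neg i))
    neg-closed {i} nz = ∖-intro all tt λ eq →
      ≢ix⇒≢ (proj₂ (∖-elim all nz)) (begin
        el i       ≡⟨ sym (⁻¹-involutive (el i)) ⟩
        - (- el i) ≡⟨ cong -_ (ix-injective eq) ⟩
        - 0#       ≡⟨ ε⁻¹≈ε ⟩
        0#         ∎)
      where open ≡-Reasoning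

    neg-involutive : ∀ i → neg (neg i) ≡ i
    neg-involutive i = begin
      ix (- el (ix (- el i))) ≡⟨ cong (ix ∘ -_) (el∘ix (- el i)) ⟩
      ix (- (- el i))         ≡⟨ cong ix (⁻¹-involutive (el i)) ⟩
      ix (el i)               ≡⟨ ix∘el i ⟩
      i                       ∎
      where open ≡-Reasoning

    neg-free : ∀ {i} → T (nonzero i) → neg i ≢ i
    neg-free {i} nz eq = ≢ix⇒≢ (proj₂ (∖-elim all nz))
      (y+y≡0⇒y≡0 2≢0 (el i) (trans (cong (el i ⊕_) (sym -el≡el)) (-‿inverseʳ (el i))))
      where
      -el≡el : - el i ≡ el i
      -el≡el = trans (sym (el∘ix (- el i))) (cong el eq)

    open FreeInvolution nonzero neg neg-closed neg-involutive neg-free using (isRep; count-even)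

    q≡odd : q ≡ suc (2 * count q isRep)
    q≡odd = trans (sym (count-all q)) (trans (count-∖ q all (ix 0#) tt) (cong suc count-even))

module Blocks {q} (F : FiniteField q) (char-two : FieldFacts.CharacteristicTwo F) where
  open FiniteField F renaming (_+_ to infixl 6 _⊕_; _*_ to infixl 7 _⊗_; _≟_ to _≈?_)
  open FieldFacts F
  open IsCommutativeRing isCommutativeRing
    using (+-isCommutativeMonoid; +-assoc; +-comm; +-identityˡ; +-identityʳ; distribˡ; *-identityʳ; zeroʳ)
  module F-sum = SubsetSum +-isCommutativeMonoid
  open ≡-Reasoning

  -- In characteristic two every element is its own negative, so an
  -- equation x + y = z can be solved for y by adding x.
  y⊕y≡0 : ∀ y → y ⊕ y ≡ 0#
  y⊕y≡0 y = begin
    y ⊕ y            ≡⟨ cong₂ _⊕_ (*-identityʳ y) (*-identityʳ y) ⟨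
    y ⊗ 1# ⊕ y ⊗ 1#  ≡⟨ distribˡ y 1# 1# ⟨
    y ⊗ (1# ⊕ 1#)    ≡⟨ cong (y ⊗_) char-two ⟩
    y ⊗ 0#           ≡⟨ zeroʳ y ⟩
    0#               ∎

  solve-for : ∀ {x y z} → x ⊕ y ≡ z → y ≡ x ⊕ z
  solve-for {x} {y} {z} x⊕y≡z = begin
    y            ≡⟨ +-identityˡ y ⟨
    0# ⊕ y       ≡⟨ cong (_⊕ y) (y⊕y≡0 x) ⟨
    (x ⊕ x) ⊕ y  ≡⟨ +-assoc x x y ⟩
    x ⊕ (x ⊕ y)  ≡⟨ cong (x ⊕_) x⊕y≡z ⟩
    x ⊕ z        ∎

  ⊕≡0⇒≡ : ∀ {x y} → x ⊕ y ≡ 0# → y ≡ x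
  ⊕≡0⇒≡ {x} x⊕y≡0 = trans (solve-for x⊕y≡0) (+-identityʳ x)

  inX : Fin q → Bool
  inX i = inXᵇ F (el i)

  inX-elim : ∀ {i} → T (inX i) → el i ≢ 0# × el i ≢ 1#
  inX-elim {i} t with Equivalence.to T-∧ t
  ... | t₀ , t₁ = toWitness {a? = ¬? (el i ≈? 0#)} t₀ , toWitness {a? = ¬? (el i ≈? 1#)} t₁

  inX-intro : ∀ {i} → el i ≢ 0# → el i ≢ 1# → T (inX i)
  inX-intro {i} ≢0 ≢1 = Equivalence.from T-∧ (fromWitness {a? = ¬? (el i ≈? 0#)} ≢0 ,
                                              fromWitness {a? = ¬? (el i ≈? 1#)} ≢1)

  ix-inX : ∀ {a} → a ≢ 0# → a ≢ 1# → T (inX (ix a))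
  ix-inX {a} a≢0 a≢1 = inX-intro (a≢0 ∘ trans (sym (el∘ix a))) (a≢1 ∘ trans (sym (el∘ix a)))

  count-X : count q inX ≡ q ∸ 2
  count-X = cong (_∸ 2) (sym (begin
    q                                        ≡⟨ count-all q ⟨
    count q all                              ≡⟨ count-∖ q all (ix 0#) tt ⟩
    suc (count q (all ∖ ix 0#))              ≡⟨ cong suc (count-∖ q (all ∖ ix 0#) (ix 1#) 1∈) ⟩
    suc (suc (count q (all ∖ ix 0# ∖ ix 1#))) ≡⟨ cong (2 +_) (count-cong q λ i → T-ext (to i) (from i)) ⟩
    suc (suc (count q inX))                  ∎))
    where
    1∈ : T ((all ∖ ix 0#) (ix 1#))
    1∈ = ∖-intro all tt (0≢1 ∘ sym ∘ ix-injective)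
    to : ∀ i → T ((all ∖ ix 0# ∖ ix 1#) i) → T (inX i)
    to i t = inX-intro (≢ix⇒≢ (proj₂ (∖-elim all (proj₁ (∖-elim (all ∖ ix 0#) {i = i} t)))))
                       (≢ix⇒≢ (proj₂ (∖-elim (all ∖ ix 0#) {i = i} t)))
    from : ∀ i → T (inX i) → T ((all ∖ ix 0# ∖ ix 1#) i)
    from i t = ∖-intro (all ∖ ix 0#) (∖-intro all tt (≢⇒≢ix (proj₁ (inX-elim t)))) (≢⇒≢ix (proj₂ (inX-elim t)))

  record IsBlock (B : Subset q) : Set where
    field
      within : ∀ {i} → T (lookup B i) → T (inX i)
      size   : count q (lookup B) ≡ 3
      sum    : F-sum.sumOver (lookup B) el ≡ 1#

  subsetSum≡sumOver : ∀ B → subsetSum F B ≡ F-sum.sumOver (lookup B) el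
  subsetSum≡sumOver B = trans (F-sum.sumOver-vec B (tabulate el))
                              (F-sum.sumOver-cong (λ _ → refl) (lookup∘tabulate el))

  isW3⇔IsBlock : ∀ B → T (isW3 F B) ⇔ IsBlock B
  isW3⇔IsBlock B = mk⇔ to from
    where
    ⊆X⇔ = T-implications (inXᵇ F) B (tabulate el)
    to : T (isW3 F B) → IsBlock B
    to t with Equivalence.to T-∧ t
    ... | t⊆X , t′ with Equivalence.to T-∧ t′
    ... | t#3 , tΣ = record
      { within = λ {i} i∈B → subst (T ∘ inXᵇ F) (lookup∘tabulate el i) (Equivalence.to ⊆X⇔ t⊆X i i∈B)
      ; size   = trans (sym (∣∣≡count B)) (ℕₚ.≡ᵇ⇒≡ _ _ t#3)
      ; sum    = trans (sym (subsetSum≡sumOver B)) (toWitness tΣ)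
      }
    from : IsBlock B → T (isW3 F B)
    from b = Equivalence.from T-∧ (Equivalence.from ⊆X⇔ within′ ,
               Equivalence.from T-∧ (ℕₚ.≡⇒≡ᵇ _ _ (trans (∣∣≡count B) (IsBlock.size b)) ,
                                     fromWitness (trans (subsetSum≡sumOver B) (IsBlock.sum b))))
      where
      within′ : ∀ i → T (lookup B i) → T (inXᵇ F (lookup (tabulate el) i))
      within′ i i∈B = subst (T ∘ inXᵇ F) (sym (lookup∘tabulate el i)) (IsBlock.within b i∈B)

  through : Fin q → Subset q → Bool
  through i B = isW3 F B ∧ lookup B i

  through-elim : ∀ {i} B → T (through i B) → IsBlock B × T (lookup B i)
  through-elim B t with Equivalence.to (T-∧ {isW3 F B}) t
  ... | w , i∈B = Equivalence.to (isW3⇔IsBlock B) w , i∈B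

  through-intro : ∀ {i} B → IsBlock B → T (lookup B i) → T (through i B)
  through-intro B b i∈B = Equivalence.from T-∧ (Equivalence.from (isW3⇔IsBlock B) b , i∈B)

  -- A block {x, y, z} sums to 1
  -- exactly when z = σ y with σ y = (1 + x) + y, an involution of F.  So
  -- the flags (B, y) with y ∈ B ∖ {x} correspond to the points y of
  -- Y = X ∖ {x, 1 + x}, and every block carries two flags.
  module Through (x : Carrier) (x≢0 : x ≢ 0#) (x≢1 : x ≢ 1#) where

    s : Carrier
    s = 1# ⊕ x

    σ : Carrier → Carrier
    σ y = s ⊕ y

    s≢0 : s ≢ 0#
    s≢0 s≡0 = x≢1 (⊕≡0⇒≡ s≡0)

    s≢1 : s ≢ 1#
    s≢1 s≡1 = x≢0 (trans (solve-for s≡1) char-two)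

    s≢x : s ≢ x
    s≢x s≡x = 0≢1 (sym (trans (solve-for (trans (+-comm x 1#) s≡x)) (y⊕y≡0 x)))

    σ-swap : ∀ {y z} → σ y ≡ z → y ≡ σ z
    σ-swap = solve-for

    σ0≡s : σ 0# ≡ s
    σ0≡s = +-identityʳ s

    σx≡1 : σ x ≡ 1#
    σx≡1 = begin
      (1# ⊕ x) ⊕ x  ≡⟨ +-assoc 1# x x ⟩
      1# ⊕ (x ⊕ x)  ≡⟨ cong (1# ⊕_) (y⊕y≡0 x) ⟩
      1# ⊕ 0#       ≡⟨ +-identityʳ 1# ⟩
      1#            ∎

    σ1≡x : σ 1# ≡ x
    σ1≡x = sym (σ-swap σx≡1)

    σ-free : ∀ y → σ y ≢ y
    σ-free y σy≡y = s≢0 (trans (solve-for (trans (+-comm y s) σy≡y)) (y⊕y≡0 y))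

    x⊕y⊕σy≡1 : ∀ y → x ⊕ (y ⊕ σ y) ≡ 1#
    x⊕y⊕σy≡1 y = begin
      x ⊕ (y ⊕ (s ⊕ y))  ≡⟨ cong (x ⊕_) (+-comm y (s ⊕ y)) ⟩
      x ⊕ ((s ⊕ y) ⊕ y)  ≡⟨ cong (x ⊕_) (+-assoc s y y) ⟩
      x ⊕ (s ⊕ (y ⊕ y))  ≡⟨ cong (λ z → x ⊕ (s ⊕ z)) (y⊕y≡0 y) ⟩
      x ⊕ (s ⊕ 0#)       ≡⟨ cong (x ⊕_) (+-identityʳ s) ⟩
      x ⊕ s              ≡⟨ +-comm x s ⟩
      σ x                ≡⟨ σx≡1 ⟩
      1#                 ∎

    third≡σ : ∀ {y z} → x ⊕ (y ⊕ z) ≡ 1# → z ≡ σ y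
    third≡σ {y} {z} sum≡1 = begin
      z                  ≡⟨ solve-for (solve-for sum≡1) ⟩
      y ⊕ (x ⊕ 1#)       ≡⟨ cong (y ⊕_) (+-comm x 1#) ⟩
      y ⊕ s              ≡⟨ +-comm y s ⟩
      σ y                ∎

    -- Y = X ∖ {x, s}: the points that can accompany x in a block.
    Y : Fin q → Bool
    Y = inX ∖ ix x ∖ ix s

    Y-elim : ∀ {i} → T (Y i) → T (inX i) × el i ≢ x × el i ≢ s
    Y-elim {i} t with ∖-elim (inX ∖ ix x) {i = i} t
    ... | t′ , i≢s = proj₁ (∖-elim inX t′) , ≢ix⇒≢ (proj₂ (∖-elim inX t′)) , ≢ix⇒≢ i≢s

    x∈X : T (inX (ix x))
    x∈X = ix-inX x≢0 x≢1

    count-Y : count q Y ≡ q ∸ 4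
    count-Y = begin
      count q Y               ≡⟨⟩
      (2 + count q Y) ∸ 2     ≡⟨ cong (_∸ 2) (sym (trans (count-∖ q inX (ix x) x∈X)
                                                         (cong suc (count-∖ q (inX ∖ ix x) (ix s) s∈)))) ⟩
      count q inX ∸ 2         ≡⟨ cong (_∸ 2) count-X ⟩
      q ∸ 2 ∸ 2               ≡⟨ ℕₚ.∸-+-assoc q 2 2 ⟩
      q ∸ 4                   ∎
      where
      s∈ : T ((inX ∖ ix x) (ix s))
      s∈ = ∖-intro inX (ix-inX s≢0 s≢1) (s≢x ∘ ix-injective)

    blockAt : Fin q → Fin q → Bool
    blockAt i = triple (ix x) i (ix (σ (el i)))

    blockAt-isBlock : ∀ {i} → T (Y i) → IsBlock (tabulate (blockAt i))
    blockAt-isBlock {i} i∈Y = record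
      { within = λ {j} j∈ → within′ (triple-∈ _ _ _ (subst T (lookup∘tabulate (blockAt i) j) j∈))
      ; size   = trans (count-cong q (lookup∘tabulate (blockAt i))) (count-triple x≢i x≢σy i≢σy)
      ; sum    = begin
          F-sum.sumOver (lookup (tabulate (blockAt i))) el ≡⟨ F-sum.sumOver-cong (lookup∘tabulate (blockAt i)) (λ _ → refl) ⟩
          F-sum.sumOver (blockAt i) el                   ≡⟨ F-sum.sumOver-triple el x≢i x≢σy i≢σy ⟩
          el (ix x) ⊕ (y ⊕ el (ix (σ y)))                ≡⟨ cong₂ (λ a b → a ⊕ (y ⊕ b)) (el∘ix x) (el∘ix (σ y)) ⟩
          x ⊕ (y ⊕ σ y)                                  ≡⟨ x⊕y⊕σy≡1 y ⟩
          1#                                             ∎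
      }
      where
      y = el i
      y∈X = proj₁ (Y-elim i∈Y)
      x≢i : ix x ≢ i
      x≢i = ≢-sym (≢⇒≢ix (proj₁ (proj₂ (Y-elim i∈Y))))
      x≢σy : ix x ≢ ix (σ y)
      x≢σy eq = proj₂ (inX-elim y∈X) (trans (σ-swap (sym (ix-injective eq))) σx≡1)
      i≢σy : i ≢ ix (σ y)
      i≢σy eq = σ-free y (sym (trans (cong el eq) (el∘ix (σ y))))
      σy≢0 : σ y ≢ 0#
      σy≢0 eq = proj₂ (proj₂ (Y-elim i∈Y)) (trans (σ-swap eq) σ0≡s)
      σy≢1 : σ y ≢ 1#
      σy≢1 eq = proj₁ (proj₂ (Y-elim i∈Y)) (trans (σ-swap eq) σ1≡x)
      within′ : ∀ {j} → j ≡ ix x ⊎ j ≡ i ⊎ j ≡ ix (σ y) → T (inX j)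
      within′ (inj₁ refl)        = x∈X
      within′ (inj₂ (inj₁ refl)) = y∈X
      within′ (inj₂ (inj₂ refl)) = ix-inX σy≢0 σy≢1

    block-through : ∀ {B i} → IsBlock B → T (lookup B (ix x)) → T (lookup B i) → i ≢ ix x →
                    ∀ j → lookup B j ≡ blockAt i j
    block-through {B} {i} b x∈B i∈B i≢x with third-point q (lookup B) (IsBlock.size b) x∈B i∈B (≢-sym i≢x)
    ... | c , x≢c , i≢c , B≗xic = subst (λ c → ∀ j → lookup B j ≡ triple (ix x) i c j) c≡ B≗xic
      where
      c≡ : c ≡ ix (σ (el i))
      c≡ = trans (sym (ix∘el c)) (cong ix (third≡σ (begin
        x ⊕ (el i ⊕ el c)               ≡⟨ cong (_⊕ (el i ⊕ el c)) (el∘ix x) ⟨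
        el (ix x) ⊕ (el i ⊕ el c)       ≡⟨ F-sum.sumOver-triple el (≢-sym i≢x) x≢c i≢c ⟨
        F-sum.sumOver (triple (ix x) i c) el ≡⟨ F-sum.sumOver-cong B≗xic (λ _ → refl) ⟨
        F-sum.sumOver (lookup B) el     ≡⟨ IsBlock.sum b ⟩
        1#                              ∎)))

    second-point∈Y : ∀ {B i} → IsBlock B → T (lookup B (ix x)) → T (lookup B i) → i ≢ ix x → T (Y i)
    second-point∈Y {B} {i} b x∈B i∈B i≢x =
      ∖-intro (inX ∖ ix x) (∖-intro inX (IsBlock.within b i∈B) i≢x) (≢⇒≢ix el≢s)
      where
      σy∈X : T (inX (ix (σ (el i))))
      σy∈X = IsBlock.within b (subst T (sym (block-through b x∈B i∈B i≢x (ix (σ (el i)))))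
                                         (triple-∋ (ix x) i (ix (σ (el i))) (inj₂ (inj₂ refl))))
      el≢s : el i ≢ s
      el≢s eq = proj₁ (inX-elim σy∈X) (begin
        el (ix (σ (el i)))  ≡⟨ el∘ix _ ⟩
        s ⊕ el i            ≡⟨ cong (s ⊕_) eq ⟩
        s ⊕ s               ≡⟨ y⊕y≡0 s ⟩
        0#                  ∎)

    Flag : Set
    Flag = Σ (W3-containing F x) λ b → Sat (lookup (proj₁ b) ∖ ix x)

    flag-≡ : ∀ {B B′ w w′ i t t′} → B ≡ B′ → _≡_ {A = Flag} ((B , w) , (i , t)) ((B′ , w′) , (i , t′))
    flag-≡ {B} {w = w} {w′} {i} {t} {t′} refl =
      cong₂ (λ w t → (B , w) , (i , t)) (T-irrelevant w w′) (T-irrelevant t t′)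

    flag↔Y : Flag ↔ Sat Y
    flag↔Y = mk↔ₛ′ flag→point point→flag (λ _ → Sat-≡ Y refl) point∘flag
      where
      flag→point : Flag → Sat Y
      flag→point ((B , w) , (i , t)) =
        i , second-point∈Y {B} {i} (proj₁ (through-elim B w)) (proj₂ (through-elim B w))
                           (proj₁ (∖-elim (lookup B) {i = i} t)) (proj₂ (∖-elim (lookup B) {i = i} t))

      point→flag : Sat Y → Flag
      point→flag (i , i∈Y) =
        (tabulate (blockAt i) , through-intro (tabulate (blockAt i)) (blockAt-isBlock i∈Y) (member (inj₁ refl))) ,
        (i , ∖-intro (lookup (tabulate (blockAt i))) (member (inj₂ (inj₁ refl)))
                     (≢⇒≢ix (proj₁ (proj₂ (Y-elim i∈Y)))))
        where
        member : ∀ {j} → j ≡ ix x ⊎ j ≡ i ⊎ j ≡ ix (σ (el i)) → T (lookup (tabulate (blockAt i)) j)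
        member {j} j∈ = subst T (sym (lookup∘tabulate (blockAt i) j)) (triple-∋ (ix x) i (ix (σ (el i))) j∈)

      point∘flag : ∀ f → point→flag (flag→point f) ≡ f
      point∘flag ((B , w) , (i , t)) = flag-≡ (trans (tabulate-cong (sym ∘ block-through {B} {i}
          (proj₁ (through-elim B w)) (proj₂ (through-elim B w))
          (proj₁ (∖-elim (lookup B) {i = i} t)) (proj₂ (∖-elim (lookup B) {i = i} t))))
        (tabulate∘lookup B))

    two-flags : ∀ (b : W3-containing F x) → Sat (lookup (proj₁ b) ∖ ix x) ↔ Fin 2
    two-flags (B , w) = subst (λ n → Sat (lookup B ∖ ix x) ↔ Fin n) #B∖x≡2 (Sat↔count q (lookup B ∖ ix x))
      where
      #B∖x≡2 : count q (lookup B ∖ ix x) ≡ 2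
      #B∖x≡2 = ℕₚ.suc-injective (trans (sym (count-∖ q (lookup B) (ix x) (proj₂ (through-elim B w))))
                                       (IsBlock.size (proj₁ (through-elim B w))))

    -- Hence r₃ = |Y| / 2 = (q - 4) / 2 blocks pass through x.
    blocks-through : W3-containing F x ↔ Fin ((q ∸ 4) / 2)
    blocks-through = subst (λ n → W3-containing F x ↔ Fin n) (sym r≡) enumeration
      where
      r : ℕ
      r = count (2 ^ q) (through (ix x) ∘ Inverse.from (Subset↔ q))
      enumeration : W3-containing F x ↔ Fin r
      enumeration = Sat↔count-via (Subset↔ q) (through (ix x))
      2r≡q-4 : r * 2 ≡ q ∸ 4
      2r≡q-4 = trans (↔⇒≡ (↔-trans (↔-sym (Σ-constant-fibres enumeration two-flags))
                          (↔-trans flag↔Y (Sat↔count q Y)))) count-Y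
      r≡ : (q ∸ 4) / 2 ≡ r
      r≡ = trans (cong (_/ 2) (sym 2r≡q-4)) (m*n/n≡m r 2)

  through-count : ∀ i → Sat (through i) ↔ Fin (if inX i then (q ∸ 4) / 2 else 0)
  through-count i with inX i in i∈X
  ... | true  = subst (λ j → Sat (through j) ↔ Fin ((q ∸ 4) / 2)) (ix∘el i)
                      (Through.blocks-through (el i) (proj₁ x∈X) (proj₂ x∈X))
    where x∈X = inX-elim (subst T (sym i∈X) tt)
  ... | false = empty↔Fin0 λ (B , t) →
    subst T i∈X (IsBlock.within (proj₁ (through-elim B t)) (proj₂ (through-elim B t)))

  pointed↔ : Σ (W3 F) (λ b → Sat (lookup (proj₁ b))) ↔ Σ (Fin q) (Sat ∘ through)
  pointed↔ = mk↔ₛ′ to′ from′ to∘from from∘to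
    where
    to′ : Σ (W3 F) (λ b → Sat (lookup (proj₁ b))) → Σ (Fin q) (Sat ∘ through)
    to′ ((B , w) , (i , i∈B)) = i , (B , Equivalence.from T-∧ (w , i∈B))
    from′ : Σ (Fin q) (Sat ∘ through) → Σ (W3 F) (λ b → Sat (lookup (proj₁ b)))
    from′ (i , (B , t)) = (B , proj₁ (Equivalence.to (T-∧ {isW3 F B}) t)) ,
                          (i , proj₂ (Equivalence.to (T-∧ {isW3 F B}) t))
    to∘from : ∀ y → to′ (from′ y) ≡ y
    to∘from (i , (B , t)) = cong (λ t → i , (B , t)) (T-irrelevant _ t)
    from∘to : ∀ y → from′ (to′ y) ≡ y
    from∘to ((B , w) , (i , i∈B)) =
      cong₂ (λ w i∈B → (B , w) , (i , i∈B)) (T-irrelevant _ w) (T-irrelevant _ i∈B)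

  #W3 : ℕ
  #W3 = count (2 ^ q) (isW3 F ∘ Inverse.from (Subset↔ q))

  W3-enumeration : W3 F ↔ Fin #W3
  W3-enumeration = Sat↔count-via (Subset↔ q) (isW3 F)

  3|W3|≡|X|r₃ : #W3 * 3 ≡ (q ∸ 2) * ((q ∸ 4) / 2)
  3|W3|≡|X|r₃ = begin
    #W3 * 3                            ≡⟨ ↔⇒≡ (↔-trans (↔-sym (Σ-constant-fibres W3-enumeration three-points))
                                                (↔-trans pointed↔ by-points)) ⟩
    sumOver all (λ i → if inX i then r else 0) ≡⟨ sumOver-all inX (λ _ → r) ⟩
    sumOver inX (λ _ → r)              ≡⟨ sumOver-const q inX r ⟩
    count q inX * r                    ≡⟨ cong (_* r) count-X ⟩
    (q ∸ 2) * r                        ∎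
    where
    r = (q ∸ 4) / 2
    three-points : ∀ (b : W3 F) → Sat (lookup (proj₁ b)) ↔ Fin 3
    three-points (B , w) = subst (λ n → Sat (lookup B) ↔ Fin n)
                                 (IsBlock.size (Equivalence.to (isW3⇔IsBlock B) w)) (Sat↔count q (lookup B))
    by-points : Σ (Fin q) (Sat ∘ through) ↔ Fin (sumOver all (λ i → if inX i then r else 0))
    by-points = ↔-trans (Σ-↔ ↔-refl λ {i} → through-count i) (Σ-Fin↔sum q _)

pow2-excess : ∀ m → 3 ≤ m → Σ ℕ λ h → 2 ^ m ≡ 4 + 2 * h
pow2-excess 0                         ()
pow2-excess 1                         (s≤s ())
pow2-excess 2                         (s≤s (s≤s ()))
pow2-excess (suc (suc (suc zero)))    _ = 2 , refl
pow2-excess (suc (suc (suc (suc t)))) _ with pow2-excess (3 + t) (s≤s (s≤s (s≤s z≤n)))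
... | h , eq = 2 + 2 * h , trans (cong (2 *_) eq) (double h)
  where
  double : ∀ h → 2 * (4 + 2 * h) ≡ 4 + 2 * (2 + 2 * h)
  double = solve-∀

W3-size-arith : ∀ q h w → q ≡ 4 + 2 * h → w * 3 ≡ (q ∸ 2) * ((q ∸ 4) / 2) →
  ((q ∸ 2) * (q ∸ 4)) / 6 ≡ w
W3-size-arith _ h w refl 3w≡ = begin
  ((2 + 2 * h) * (2 * h)) / 6              ≡⟨ cong (_/ 6) (regroup h) ⟩
  (2 * ((2 + 2 * h) * h)) / 6              ≡⟨ cong (λ k → (2 * ((2 + 2 * h) * k)) / 6) (half h) ⟨
  (2 * ((2 + 2 * h) * ((2 * h) / 2))) / 6  ≡⟨ cong (λ n → (2 * n) / 6) 3w≡ ⟨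
  (2 * (w * 3)) / 6                        ≡⟨ cong (_/ 6) (twice-thrice w) ⟩
  (w * 6) / 6                              ≡⟨ m*n/n≡m w 6 ⟩
  w                                        ∎
  where
  open ≡-Reasoning
  half : ∀ h → (2 * h) / 2 ≡ h
  half h = trans (cong (_/ 2) (ℕₚ.*-comm 2 h)) (m*n/n≡m h 2)
  regroup : ∀ h → (2 + 2 * h) * (2 * h) ≡ 2 * ((2 + 2 * h) * h)
  regroup = solve-∀
  twice-thrice : ∀ w → 2 * (w * 3) ≡ w * 6
  twice-thrice = solve-∀

corollary3p7 : (m : ℕ) → 3 ≤ m → (F : FiniteField (2 ^ m)) →
    ((x : FiniteField.Carrier F) → x ≢ FiniteField.0# F → x ≢ FiniteField.1# F →
       W3-containing F x ↔ Fin ((2 ^ m ∸ 4) / 2))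
    × (W3 F ↔ Fin (((2 ^ m ∸ 2) * (2 ^ m ∸ 4)) / 6))
corollary3p7 m 3≤m F =
  Through.blocks-through ,
  subst (λ n → W3 F ↔ Fin n) (sym (W3-size-arith (2 ^ m) h #W3 q≡4+2h 3|W3|≡|X|r₃)) W3-enumeration
  where
  h = proj₁ (pow2-excess m 3≤m)
  q≡4+2h = proj₂ (pow2-excess m 3≤m)
  char-two = FieldFacts.even-order⇒char-two F (2 + h) (trans q≡4+2h (sym (ℕₚ.*-distribˡ-+ 2 2 h)))
  open Blocks F char-two
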